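{- Let $G=(V,E)$ be a finite simple graph and $u,v\in V$ with $uv\in E$, $N(u)\cap N(v)=\emptyset$, and $d(u)=d(v)=2$. Then $\mathrm{mmfvs}(G/uv)=\mathrm{mmfvs}(G)$.
   Context: All graphs are finite, simple and loopless. $N(x)$ is the neighbourhood and $d(x)=|N(x)|$ the degree of $x$. For an edge $uv$, $G/uv$ is the graph obtained by contracting $uv$: $u,v$ are replaced by a single new vertex adjacent to $(N(u)\cup N(v))\setminus\{u,v\}$. A feedback vertex set (fvs) of $G$ is a set $S\subseteq V$ such that the subgraph induced by $V\setminus S$ is a forest. An fvs is minimal if no proper subset of it is an fvs. $\mathrm{mmfvs}(G)$ denotes the maximum size of a minimal feedback vertex set of $G$. -}

module Defs where

open import Data.Nat using (ℕ; suc; _≤_)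
open import Data.Bool using (Bool; true; false; _∧_; _∨_; not)
open import Data.Fin using (Fin; punchIn; _≟_)
open import Data.Fin.Subset using (Subset; _∈_; _∉_; _⊂_; ∣_∣)
open import Data.Vec using (tabulate)
open import Data.List using (List; []; _∷_; _∷ʳ_; length)
open import Data.List.Relation.Unary.All using (All)
open import Data.List.Relation.Unary.Unique.Propositional using (Unique)
open import Data.List.Relation.Unary.Linked using (Linked)
open import Data.Product using (Σ; _×_)
open import Relation.Binary.PropositionalEquality using (_≡_)
open import Relation.Nullary using (¬_)
open import Relation.Nullary.Decidable using (⌊_⌋)

record Graph (n : ℕ) : Set where
  field
    adj    : Fin n → Fin n → Bool
    sym    : ∀ x y → adj x y ≡ adj y x
    irrefl : ∀ x → adj x x ≡ false
open Graph public

Adj : ∀ {n} → (Fin n → Fin n → Bool) → Fin n → Fin n → Set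
Adj E x y = E x y ≡ true

N : ∀ {n} → Graph n → Fin n → Subset n
N G x = tabulate (adj G x)

deg : ∀ {n} → Graph n → Fin n → ℕ
deg G x = ∣ N G x ∣

IsCycle : ∀ {n} → (Fin n → Fin n → Bool) → List (Fin n) → Set
IsCycle E [] = Data.Empty.⊥ where import Data.Empty
IsCycle E (x ∷ ys) =
  (2 ≤ length ys) × Unique (x ∷ ys) × Linked (Adj E) ((x ∷ ys) ∷ʳ x)

IsFVS : ∀ {n} → (Fin n → Fin n → Bool) → Subset n → Set
IsFVS E S = ∀ (c : List _) → IsCycle E c → ¬ All (_∉ S) c

IsMinimalFVS : ∀ {n} → (Fin n → Fin n → Bool) → Subset n → Set
IsMinimalFVS E S = IsFVS E S × (∀ T → T ⊂ S → ¬ IsFVS E T)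

IsMMFVS : ∀ {n} → (Fin n → Fin n → Bool) → ℕ → Set
IsMMFVS E k =
  Σ (Subset _) (λ S → IsMinimalFVS E S × ∣ S ∣ ≡ k)
  × (∀ S → IsMinimalFVS E S → ∣ S ∣ ≤ k)

-- Contraction G/uv on vertex set Fin m: vertex v is deleted (vertices of
-- G/uv are identified with V \ {v} via punchIn v) and u plays the role of
-- the new merged vertex, adjacent to (N(u) ∪ N(v)) \ {u,v}.
contract : ∀ {m} → Graph (suc m) → (u v : Fin (suc m)) → Fin m → Fin m → Bool
contract G u v x y =
  not ⌊ x ≟ y ⌋ ∧
    (adj G x' y'
     ∨ (⌊ x' ≟ u ⌋ ∧ adj G v y')
     ∨ (⌊ y' ≟ u ⌋ ∧ adj G x' v))
  where
  x' = punchIn v x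
  y' = punchIn v y

module Submission where

-- Identify the vertices of G/uv with V \ {v} via φ = punchIn v, so that the merged vertex is u, and map
-- a vertex set X of G to its image in G/uv. Since u and v have degree 2 and are adjacent, a cycle of G
-- through one of them passes through the edge uv; contracting that edge gives a cycle of G/uv (not a
-- triangle, since u and v have no common neighbour). Conversely the two cycle-neighbours of the merged
-- vertex are attached one to u and one to v (neither has a third neighbour), so the cycle expands through
-- uv. Hence X is an FVS of G iff its image is an FVS of G/uv. A minimal FVS of G never contains both u and
-- v (dropping v leaves the image unchanged), so images and lifts along φ give size-preserving maps between
-- the minimal FVSs of the two graphs in both directions.

open import Data.Bool using (Bool; true; false; T; not; _∧_; _∨_)
open import Data.Bool.Properties using (T-≡; T-∧; T-∨; ∨-zeroʳ)
open import Data.Empty using (⊥; ⊥-elim)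
open import Data.Fin using (Fin; zero; suc; punchIn; punchOut; _≟_)
open import Data.Fin.Properties using (punchOut-punchIn; punchInᵢ≢i; punchIn-injective; punchIn-punchOut)
open import Data.Fin.Subset using (Subset; _∈_; _∉_; _⊆_; _⊂_; _∩_; _-_; ∣_∣; inside; outside)
open import Data.Fin.Subset.Properties
  using (x∈p⇒∣p-x∣<∣p∣; x∈p∧x≢y⇒x∈p-y; x∈p⇒p-x⊂p; p─q⊆p; p∩q⊆p; x∈p∩q⁺; x∈p∩q⁻; ⊆-antisym)
open import Data.List using (List; []; _∷_; _∷ʳ_; _++_; [_]; length; map)
open import Data.List.Properties using (++-assoc; ++-identityʳ; length-map; length-++-comm)
open import Data.List.Membership.Propositional using () renaming (_∈_ to _∈ₗ_)
open import Data.List.Relation.Binary.Permutation.Propositional using (↭⇒↭ₛ)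
open import Data.List.Relation.Binary.Permutation.Propositional.Properties using (∷↭∷ʳ; All-resp-↭)
import Data.List.Relation.Binary.Permutation.Setoid.Properties as Permutationₛ
open import Data.List.Relation.Unary.All as All using (All; []; _∷_)
import Data.List.Relation.Unary.All.Properties as All
open import Data.List.Relation.Unary.All.Properties using (¬Any⇒All¬)
open import Data.List.Relation.Unary.AllPairs using (_∷_)
open import Data.List.Relation.Unary.Any using (here; there; any?)
open import Data.List.Relation.Unary.Linked as Linked using (Linked; []; [-]; _∷_)
import Data.List.Relation.Unary.Linked.Properties as Linked
open import Data.List.Relation.Unary.Unique.Propositional using (Unique)
import Data.List.Relation.Unary.Unique.Propositional.Properties as Unique
open import Data.Nat using (ℕ; suc; _+_; _≤_; s≤s; z≤n)
open import Data.Nat.Properties using (module ≤-Reasoning)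
open import Data.Product as Product using (∃; ∃₂; _×_; _,_; proj₁; proj₂)
open import Data.Sum as Sum using (_⊎_; inj₁; inj₂; [_,_]′)
open import Data.Vec using (Vec; _∷_; lookup; insertAt; removeAt; updateAt; _[_]≔_; here; there)
open import Data.Vec.Properties
  using (lookup∘tabulate; lookup⇒[]=; []=⇒lookup; removeAt-punchOut; insertAt-punchIn; insertAt-lookup;
         insertAt-removeAt; lookup∘updateAt; lookup∘updateAt′; updateAt-id)
open import Function using (_∘_)
open import Function.Bundles using (module Equivalence)
open import Level using (0ℓ)
open import Relation.Binary.Core using (Rel)
open import Relation.Binary.PropositionalEquality using (_≡_; _≢_; refl; sym; trans; cong; cong₂; subst; setoid)
open import Relation.Nullary using (¬_; yes; no)
open import Relation.Nullary.Decidable using (⌊_⌋; toWitness; fromWitness; toWitnessFalse; fromWitnessFalse)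
open import Relation.Unary using (Pred)

open import Defs hiding (sym)

open Equivalence using (to; from)

module _ {A : Set} where

  lastOf : A → List A → A
  lastOf x []       = x
  lastOf x (y ∷ ys) = lastOf y ys

  lastOf∈ : ∀ x ys → lastOf x ys ∈ₗ x ∷ ys
  lastOf∈ x []       = here refl
  lastOf∈ x (y ∷ ys) = there (lastOf∈ y ys)

  lastOf-∷ʳ : ∀ x ys {z} → lastOf x (ys ∷ʳ z) ≡ z
  lastOf-∷ʳ x []       = refl
  lastOf-∷ʳ x (y ∷ ys) = lastOf-∷ʳ y ys

  head≢lastOf : ∀ {x y ys} → Unique (x ∷ y ∷ ys) → x ≢ lastOf y ys
  head≢lastOf {y = y} {ys} (x∉ ∷ _) = All.lookup x∉ (lastOf∈ y ys)

  Linked-∷ʳ⁺ : ∀ {R : Rel A 0ℓ} {x z} ys → Linked R (x ∷ ys) → R (lastOf x ys) z → Linked R (x ∷ ys ∷ʳ z)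
  Linked-∷ʳ⁺ []       [-]      r = r ∷ [-]
  Linked-∷ʳ⁺ (y ∷ ys) (r ∷ l) r′ = r ∷ Linked-∷ʳ⁺ ys l r′

  Linked-∷ʳ⁻ : ∀ {R : Rel A 0ℓ} {x z} ys → Linked R (x ∷ ys ∷ʳ z) → Linked R (x ∷ ys) × R (lastOf x ys) z
  Linked-∷ʳ⁻ []       (r ∷ [-]) = [-] , r
  Linked-∷ʳ⁻ (y ∷ ys) (r ∷ l)   = let l′ , r′ = Linked-∷ʳ⁻ ys l in r ∷ l′ , r′

  record Cycle (R : Rel A 0ℓ) (P : Pred A 0ℓ) (h : A) (ys : List A) : Set where
    constructor cycle
    field
      path     : Linked R (h ∷ ys)
      closing  : R (lastOf h ys) h
      distinct : Unique (h ∷ ys)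
      long     : 2 ≤ length ys
      vertices : All P (h ∷ ys)

  module _ {R : Rel A 0ℓ} {P : Pred A 0ℓ} where

    rotate-one : ∀ {h y zs} → Cycle R P h (y ∷ zs) → Cycle R P y (zs ∷ʳ h)
    rotate-one {h} {y} {zs} (cycle (r ∷ l) r′ d lg ps) = cycle
      (Linked-∷ʳ⁺ zs l r′)
      (subst (λ x → R x y) (sym (lastOf-∷ʳ y zs)) r)
      (Unique-resp-↭ (↭⇒↭ₛ h↭) d)
      (subst (2 ≤_) (sym (length-++-comm zs [ h ])) lg)
      (All-resp-↭ h↭ ps)
      where
      open Permutationₛ (setoid A) using (Unique-resp-↭)
      h↭ = ∷↭∷ʳ h (y ∷ zs)

    rotate : ∀ {h t} ys {rest} → t ∈ₗ ys → Cycle R P h (ys ++ rest) → ∃ (Cycle R P t)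
    rotate (y ∷ ys) (here refl) c = _ , rotate-one c
    rotate {h} (y ∷ ys) {rest} (there t∈ys) c =
      rotate ys t∈ys (subst (Cycle R P y) (++-assoc ys rest [ h ]) (rotate-one c))

    rotate-to : ∀ {h t ys} → t ∈ₗ h ∷ ys → Cycle R P h ys → ∃ (Cycle R P t)
    rotate-to               (here refl)  c = _ , c
    rotate-to {h} {ys = ys} (there t∈ys) c =
      rotate ys t∈ys (subst (Cycle R P h) (sym (++-identityʳ ys)) c)

    restrict : ∀ {Q : Pred A 0ℓ} {h ys} → Cycle R P h ys → All Q (h ∷ ys) → Cycle R (λ x → P x × Q x) h ys
    restrict (cycle l r d lg ps) qs = cycle l r d lg (All.zip (ps , qs))

  Linked-map : ∀ {B : Set} {R : Rel A 0ℓ} {S : Rel B 0ℓ} {P : Pred A 0ℓ} {f : A → B}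
             → (∀ {x y} → P x → P y → R x y → S (f x) (f y))
             → ∀ {xs} → All P xs → Linked R xs → Linked S (map f xs)
  Linked-map t _              []      = []
  Linked-map t _              [-]     = [-]
  Linked-map t (px ∷ py ∷ ps) (r ∷ l) = t px py r ∷ Linked-map t (py ∷ ps) l

module _ {A B : Set} (f : A → B) where

  lastOf-map : ∀ x ys → lastOf (f x) (map f ys) ≡ f (lastOf x ys)
  lastOf-map x []       = refl
  lastOf-map x (y ∷ ys) = lastOf-map y ys

  Cycle-map : ∀ {R : Rel A 0ℓ} {S : Rel B 0ℓ} {P : Pred A 0ℓ} {Q : Pred B 0ℓ}
            → (∀ {x y} → f x ≡ f y → x ≡ y)
            → (∀ {x y} → P x → P y → R x y → S (f x) (f y))
            → (∀ {x} → P x → Q (f x))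
            → ∀ {h ys} → Cycle R P h ys → Cycle S Q (f h) (map f ys)
  Cycle-map {S = S} inj t tp {h} {ys} (cycle l r d lg ps) = cycle
    (Linked-map t ps l)
    (subst (λ x → S x (f h)) (sym (lastOf-map h ys)) (t (All.lookup ps (lastOf∈ h ys)) (All.head ps) r))
    (Unique.map⁺ inj d)
    (subst (2 ≤_) (sym (length-map f ys)) lg)
    (All.map⁺ (All.map tp ps))

  Cycle-comap : ∀ {R : Rel B 0ℓ} {S : Rel A 0ℓ} {P : Pred B 0ℓ} {Q : Pred A 0ℓ}
              → (∀ {x y} → R (f x) (f y) → S x y)
              → (∀ {x} → P (f x) → Q x)
              → ∀ {h ys} → Cycle R P (f h) (map f ys) → Cycle S Q h ys
  Cycle-comap {R = R} t tp {h} {ys} (cycle l r d lg ps) = cycle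
    (Linked.map t (Linked.map⁻ l))
    (t (subst (λ x → R x (f h)) (lastOf-map h ys) r))
    (Unique.map⁻ d)
    (subst (2 ≤_) (length-map f ys) lg)
    (All.map tp (All.map⁻ ps))

module _ {n} (G : Graph n) where

  Adj-sym : ∀ {x y} → Adj (adj G) x y → Adj (adj G) y x
  Adj-sym {x} {y} e = trans (Graph.sym G y x) e

  Adj-irrefl : ∀ {x y} → Adj (adj G) x y → x ≢ y
  Adj-irrefl {x} e refl with trans (sym e) (irrefl G x)
  ... | ()

  Adj⇒∈N : ∀ {x y} → Adj (adj G) x y → y ∈ N G x
  Adj⇒∈N {x} {y} e = lookup⇒[]= y _ (trans (lookup∘tabulate (adj G x) y) e)

  three-neighbours⇒3≤deg : ∀ {x a b c}
    → Adj (adj G) x a → Adj (adj G) x b → Adj (adj G) x c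
    → a ≢ b → a ≢ c → b ≢ c → 3 ≤ deg G x
  three-neighbours⇒3≤deg {x} {a} {b} {c} xa xb xc a≢b a≢c b≢c = begin
    3                   ≤⟨ s≤s (s≤s (s≤s z≤n)) ⟩
    3 + ∣ Nx - a - b - c ∣ ≤⟨ s≤s (s≤s (x∈p⇒∣p-x∣<∣p∣ c∈)) ⟩
    2 + ∣ Nx - a - b ∣     ≤⟨ s≤s (x∈p⇒∣p-x∣<∣p∣ b∈) ⟩
    1 + ∣ Nx - a ∣         ≤⟨ x∈p⇒∣p-x∣<∣p∣ (Adj⇒∈N xa) ⟩
    ∣ Nx ∣                 ∎
    where
    open ≤-Reasoning
    Nx = N G x
    b∈ : b ∈ Nx - a
    b∈ = x∈p∧x≢y⇒x∈p-y (Adj⇒∈N xb) (a≢b ∘ sym)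
    c∈ : c ∈ Nx - a - b
    c∈ = x∈p∧x≢y⇒x∈p-y (x∈p∧x≢y⇒x∈p-y (Adj⇒∈N xc) (a≢c ∘ sym)) (b≢c ∘ sym)

  deg≡2⇒third-neighbour : ∀ {x w a b} → deg G x ≡ 2
    → Adj (adj G) x w → Adj (adj G) x a → Adj (adj G) x b → a ≢ b → a ≡ w ⊎ b ≡ w
  deg≡2⇒third-neighbour {x} {w} {a} {b} d xw xa xb a≢b with a ≟ w | b ≟ w
  ... | yes a≡w | _       = inj₁ a≡w
  ... | no _    | yes b≡w = inj₂ b≡w
  ... | no a≢w  | no b≢w  with subst (3 ≤_) d (three-neighbours⇒3≤deg xw xa xb (a≢w ∘ sym) (b≢w ∘ sym) a≢b)
  ...   | s≤s (s≤s ())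

module _ {n} {E : Fin n → Fin n → Bool} {S : Subset n} where

  IsFVS⇒acyclic : IsFVS E S → ∀ {h ys} → ¬ Cycle (Adj E) (_∉ S) h ys
  IsFVS⇒acyclic fvs {h} {ys} (cycle l r d lg ps) = fvs (h ∷ ys) (lg , d , Linked-∷ʳ⁺ ys l r) ps

  acyclic⇒IsFVS : (∀ {h ys} → ¬ Cycle (Adj E) (_∉ S) h ys) → IsFVS E S
  acyclic⇒IsFVS acyclic (h ∷ ys) (lg , d , l) ps =
    let l′ , r = Linked-∷ʳ⁻ ys l in acyclic (cycle l′ r d lg ps)

∈-resp-lookup : ∀ {n k} {p : Subset n} {q : Subset k} {x y} → lookup p x ≡ lookup q y → x ∈ p → y ∈ q
∈-resp-lookup {y = y} e x∈p = lookup⇒[]= y _ (trans (sym e) ([]=⇒lookup x∈p))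

lookup-removeAt : ∀ {A : Set} {n} (xs : Vec A (suc n)) i j → lookup (removeAt xs i) j ≡ lookup xs (punchIn i j)
lookup-removeAt xs i j =
  trans (cong (lookup (removeAt xs i)) (sym (punchOut-punchIn i))) (removeAt-punchOut xs (punchInᵢ≢i i j ∘ sym))

∣insertAt∣ : ∀ {n} (p : Subset n) i s → ∣ insertAt p i s ∣ ≡ ∣ s ∷ p ∣
∣insertAt∣ p             zero    s       = refl
∣insertAt∣ (outside ∷ p) (suc i) outside = ∣insertAt∣ p i outside
∣insertAt∣ (outside ∷ p) (suc i) inside  = ∣insertAt∣ p i inside
∣insertAt∣ (inside ∷ p)  (suc i) outside = cong suc (∣insertAt∣ p i outside)
∣insertAt∣ (inside ∷ p)  (suc i) inside  = cong suc (∣insertAt∣ p i inside)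

∣p[i]≔inside∣ : ∀ {n} (p : Subset n) i → i ∉ p → ∣ p [ i ]≔ inside ∣ ≡ suc ∣ p ∣
∣p[i]≔inside∣ (outside ∷ p) zero    i∉p = refl
∣p[i]≔inside∣ (inside ∷ p)  zero    i∉p = ⊥-elim (i∉p here)
∣p[i]≔inside∣ (outside ∷ p) (suc i) i∉p = ∣p[i]≔inside∣ p i (i∉p ∘ there)
∣p[i]≔inside∣ (inside ∷ p)  (suc i) i∉p = cong suc (∣p[i]≔inside∣ p i (i∉p ∘ there))

module Contraction {m} (G : Graph (suc m)) (u v : Fin (suc m)) (u~v : Adj (adj G) u v) where

  private
    E  = adj G
    E′ = contract G u v

  φ : Fin m → Fin (suc m)
  φ = punchIn v

  φ-injective : ∀ {x y} → φ x ≡ φ y → x ≡ y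
  φ-injective = punchIn-injective v _ _

  v≢φ : ∀ x → v ≢ φ x
  v≢φ x = punchInᵢ≢i v x ∘ sym

  v≢u : v ≢ u
  v≢u = Adj-irrefl G u~v ∘ sym

  merged : Fin m
  merged = punchOut v≢u

  φ-merged : φ merged ≡ u
  φ-merged = punchIn-punchOut v≢u

  data MergedEdge (x y : Fin m) : Set where
    edge    : Adj E (φ x) (φ y) → MergedEdge x y
    v-edgeˡ : φ x ≡ u → Adj E v (φ y) → MergedEdge x y
    v-edgeʳ : φ y ≡ u → Adj E (φ x) v → MergedEdge x y

  private
    via-vˡ via-vʳ : Fin m → Fin m → Bool
    via-vˡ x y = ⌊ φ x ≟ u ⌋ ∧ E v (φ y)
    via-vʳ x y = ⌊ φ y ≟ u ⌋ ∧ E (φ x) v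

  contract-adj⁻ : ∀ {x y} → Adj E′ x y → x ≢ y × MergedEdge x y
  contract-adj⁻ {x} {y} e with to (T-∧ {not ⌊ x ≟ y ⌋}) (from T-≡ e)
  ... | x≢y , rest = toWitnessFalse x≢y , merged-edge (to (T-∨ {E (φ x) (φ y)}) rest)
    where
    merged-edge : T (E (φ x) (φ y)) ⊎ T (via-vˡ x y ∨ via-vʳ x y) → MergedEdge x y
    merged-edge (inj₁ a) = edge (to T-≡ a)
    merged-edge (inj₂ bc) with to (T-∨ {via-vˡ x y}) bc
    ... | inj₁ b = let p , q = to (T-∧ {⌊ φ x ≟ u ⌋}) b in v-edgeˡ (toWitness p) (to T-≡ q)
    ... | inj₂ c = let p , q = to (T-∧ {⌊ φ y ≟ u ⌋}) c in v-edgeʳ (toWitness p) (to T-≡ q)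

  contract-adj⁺ : ∀ {x y} → x ≢ y → MergedEdge x y → Adj E′ x y
  contract-adj⁺ {x} {y} x≢y me =
    to T-≡ (from (T-∧ {not ⌊ x ≟ y ⌋}) (fromWitnessFalse x≢y , from (T-∨ {E (φ x) (φ y)}) (disjunct me)))
    where
    disjunct : MergedEdge x y → T (E (φ x) (φ y)) ⊎ T (via-vˡ x y ∨ via-vʳ x y)
    disjunct (edge e)      = inj₁ (from T-≡ e)
    disjunct (v-edgeˡ p e) = inj₂ (from (T-∨ {via-vˡ x y}) (inj₁ (from (T-∧ {⌊ φ x ≟ u ⌋}) (fromWitness p , from T-≡ e))))
    disjunct (v-edgeʳ p e) = inj₂ (from (T-∨ {via-vˡ x y}) (inj₂ (from (T-∧ {⌊ φ y ≟ u ⌋}) (fromWitness p , from T-≡ e))))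

  contract-sym : ∀ {x y} → Adj E′ x y → Adj E′ y x
  contract-sym e with contract-adj⁻ e
  ... | x≢y , edge a      = contract-adj⁺ (x≢y ∘ sym) (edge (Adj-sym G a))
  ... | x≢y , v-edgeˡ p a = contract-adj⁺ (x≢y ∘ sym) (v-edgeʳ p (Adj-sym G a))
  ... | x≢y , v-edgeʳ p a = contract-adj⁺ (x≢y ∘ sym) (v-edgeˡ p (Adj-sym G a))

  merged-neighbour : ∀ {y} → Adj E′ merged y → Adj E u (φ y) ⊎ Adj E v (φ y)
  merged-neighbour {y} e with contract-adj⁻ e
  ... | _     , edge a      = inj₁ (subst (λ w → Adj E w (φ y)) φ-merged a)
  ... | _     , v-edgeˡ _ a = inj₂ a
  ... | m≢y   , v-edgeʳ p _ = ⊥-elim (m≢y (φ-injective (trans φ-merged (sym p))))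

  -- image X drops v and adds merged when v ∈ X; preimage R is the set of vertices of G sent into R
  -- when v is sent to merged.
  opaque
    lift : Subset m → Subset (suc m)
    lift S = insertAt S v outside

    image : Subset (suc m) → Subset m
    image X = updateAt (removeAt X v) merged (lookup X v ∨_)

    preimage : Subset m → Subset (suc m)
    preimage R = insertAt R v (lookup R merged)

    ∈-lift : ∀ {S x} → x ∈ S → φ x ∈ lift S
    ∈-lift {S} {x} = ∈-resp-lookup (sym (insertAt-punchIn S v outside x))

    ∈-lift⁻ : ∀ {S x} → φ x ∈ lift S → x ∈ S
    ∈-lift⁻ {S} {x} = ∈-resp-lookup (insertAt-punchIn S v outside x)

    v∉lift : ∀ {S} → v ∉ lift S
    v∉lift {S} v∈ with trans (sym (insertAt-lookup S v outside)) ([]=⇒lookup v∈)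
    ... | ()

    ∈-preimage : ∀ {R x} → x ∈ R → φ x ∈ preimage R
    ∈-preimage {R} {x} = ∈-resp-lookup (sym (insertAt-punchIn R v _ x))

    ∈-preimage⁻ : ∀ {R x} → φ x ∈ preimage R → x ∈ R
    ∈-preimage⁻ {R} {x} = ∈-resp-lookup (insertAt-punchIn R v _ x)

    v∈preimage : ∀ {R} → merged ∈ R → v ∈ preimage R
    v∈preimage {R} = ∈-resp-lookup (sym (insertAt-lookup R v _))

    v∈preimage⁻ : ∀ {R} → v ∈ preimage R → merged ∈ R
    v∈preimage⁻ {R} = ∈-resp-lookup (insertAt-lookup R v _)

    lookup-image-merged : ∀ X → lookup (image X) merged ≡ lookup X v ∨ lookup X u
    lookup-image-merged X = trans (lookup∘updateAt merged (removeAt X v))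
      (cong (lookup X v ∨_) (trans (lookup-removeAt X v merged) (cong (lookup X) φ-merged)))

    lookup-image : ∀ X {x} → x ≢ merged → lookup (image X) x ≡ lookup X (φ x)
    lookup-image X {x} x≢m = trans (lookup∘updateAt′ x merged x≢m (removeAt X v)) (lookup-removeAt X v x)

    ∈-image⁻ : ∀ {X x} → x ∈ image X → φ x ∈ X ⊎ (x ≡ merged × v ∈ X)
    ∈-image⁻ {X} {x} x∈ with x ≟ merged
    ... | no x≢m    = inj₁ (∈-resp-lookup (lookup-image X x≢m) x∈)
    ... | yes refl = by-v (lookup X v) refl (trans (sym (lookup-image-merged X)) ([]=⇒lookup x∈))
      where
      by-v : ∀ b → lookup X v ≡ b → b ∨ lookup X u ≡ true → φ merged ∈ X ⊎ (merged ≡ merged × v ∈ X)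
      by-v true  Xv _  = inj₂ (refl , lookup⇒[]= v X Xv)
      by-v false _  Xu = inj₁ (subst (_∈ X) (sym φ-merged) (lookup⇒[]= u X Xu))

    ∈-image : ∀ {X x} → φ x ∈ X ⊎ (x ≡ merged × v ∈ X) → x ∈ image X
    ∈-image {X} (inj₂ (refl , v∈)) =
      lookup⇒[]= merged _ (trans (lookup-image-merged X) (cong (_∨ lookup X u) ([]=⇒lookup v∈)))
    ∈-image {X} {x} (inj₁ φx∈) with x ≟ merged
    ... | no x≢m    = ∈-resp-lookup (sym (lookup-image X x≢m)) φx∈
    ... | yes refl = lookup⇒[]= merged _ (trans (lookup-image-merged X)
      (trans (cong (lookup X v ∨_) ([]=⇒lookup (subst (_∈ X) φ-merged φx∈))) (∨-zeroʳ _)))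

    ∣lift∣ : ∀ S → ∣ lift S ∣ ≡ ∣ S ∣
    ∣lift∣ S = ∣insertAt∣ S v outside

    ∣image∣ : ∀ X → ¬ (u ∈ X × v ∈ X) → ∣ image X ∣ ≡ ∣ X ∣
    ∣image∣ X not-both = trans (by-v (lookup X v) refl) (sym ∣X∣)
      where
      p : Subset m
      p = removeAt X v
      ∣X∣ : ∣ X ∣ ≡ ∣ lookup X v ∷ p ∣
      ∣X∣ = trans (cong ∣_∣ (sym (insertAt-removeAt X v))) (∣insertAt∣ p v (lookup X v))
      by-v : ∀ b → lookup X v ≡ b → ∣ updateAt p merged (b ∨_) ∣ ≡ ∣ b ∷ p ∣
      by-v false _  = cong ∣_∣ (updateAt-id merged p)
      by-v true  Xv = ∣p[i]≔inside∣ p merged λ m∈ →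
        not-both (∈-resp-lookup (trans (lookup-removeAt X v merged) (cong (lookup X) φ-merged)) m∈ , lookup⇒[]= v X Xv)

  image-mono : ∀ {X Y} → X ⊆ Y → image X ⊆ image Y
  image-mono X⊆Y x∈ = ∈-image (Sum.map X⊆Y (Product.map₂ X⊆Y) (∈-image⁻ x∈))

  image-lift : ∀ S → image (lift S) ≡ S
  image-lift S = ⊆-antisym
    (λ x∈ → [ ∈-lift⁻ , (λ (_ , v∈) → ⊥-elim (v∉lift v∈)) ]′ (∈-image⁻ x∈))
    (λ x∈ → ∈-image (inj₁ (∈-lift x∈)))

  image-restrict : ∀ {T R} → R ⊆ image T → image (T ∩ preimage R) ≡ R
  image-restrict {T} {R} R⊆ = ⊆-antisym ⊆R R⊆image
    where
    ⊆R : image (T ∩ preimage R) ⊆ R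
    ⊆R x∈ with ∈-image⁻ x∈
    ... | inj₁ φx∈       = ∈-preimage⁻ (proj₂ (x∈p∩q⁻ T _ φx∈))
    ... | inj₂ (refl , v∈) = v∈preimage⁻ (proj₂ (x∈p∩q⁻ T _ v∈))
    R⊆image : R ⊆ image (T ∩ preimage R)
    R⊆image x∈ with ∈-image⁻ (R⊆ x∈)
    ... | inj₁ φx∈T        = ∈-image {T ∩ preimage R} (inj₁ (x∈p∩q⁺ (φx∈T , ∈-preimage x∈)))
    ... | inj₂ (refl , v∈T) = ∈-image {T ∩ preimage R} (inj₂ (refl , x∈p∩q⁺ (v∈T , v∈preimage x∈)))

  φ≢u : ∀ {x} → merged ≢ x → φ x ≢ u
  φ≢u m≢x φx≡u = m≢x (φ-injective (trans φ-merged (sym φx≡u)))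

  edge-away-from-merged : ∀ {x y} → merged ≢ x → merged ≢ y → Adj E′ x y → Adj E (φ x) (φ y)
  edge-away-from-merged m≢x m≢y e with contract-adj⁻ e
  ... | _ , edge a      = a
  ... | _ , v-edgeˡ p _ = ⊥-elim (φ≢u m≢x p)
  ... | _ , v-edgeʳ p _ = ⊥-elim (φ≢u m≢y p)

  edge-contract : ∀ {x y} → Adj E (φ x) (φ y) → Adj E′ x y
  edge-contract a = contract-adj⁺ (Adj-irrefl G a ∘ cong φ) (edge a)

  ∉-image⇒φ∉ : ∀ {X x} → x ∉ image X → φ x ∉ X
  ∉-image⇒φ∉ x∉ φx∈ = x∉ (∈-image (inj₁ φx∈))

  ∉-image : ∀ {X x} → φ x ∉ X → (x ≡ merged → v ∉ X) → x ∉ image X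
  ∉-image φx∉ v∉ x∈ = [ φx∉ , (λ (x≡m , v∈) → v∉ x≡m v∈) ]′ (∈-image⁻ x∈)

  pull-back : ∀ ys → All (v ≢_) ys → ∃ λ xs → map φ xs ≡ ys
  pull-back []       []           = [] , refl
  pull-back (y ∷ ys) (v≢y ∷ v∉ys) =
    let xs , eq = pull-back ys v∉ys in punchOut v≢y ∷ xs , cong₂ _∷_ (punchIn-punchOut v≢y) eq

  module DegreeTwo (disjoint : ∀ w → w ∈ N G u → ¬ (w ∈ N G v)) (deg-u : deg G u ≡ 2) (deg-v : deg G v ≡ 2) where

    no-common-neighbour : ∀ {w} → Adj E u w → Adj E v w → ⊥
    no-common-neighbour {w} uw vw = disjoint w (Adj⇒∈N G uw) (Adj⇒∈N G vw)

    cycle-through-merged : ∀ X {ys} → Cycle (Adj E′) (_∉ image X) merged ys → ∃₂ (Cycle (Adj E) (_∉ X))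
    cycle-through-merged X {_ ∷ []} (cycle _ _ _ (s≤s ()) _)
    cycle-through-merged X {s ∷ z ∷ zs} (cycle (m~s ∷ path) closing (m∉ ∷ distinct) _ (m∉X ∷ ps)) =
      close (merged-neighbour m~s) (merged-neighbour (contract-sym closing))
      where
      mid  = z ∷ zs
      p    = lastOf s mid
      φmid = map φ (s ∷ mid)

      φs≢φp : φ s ≢ φ p
      φs≢φp = head≢lastOf distinct ∘ φ-injective

      u∉X : u ∉ X
      u∉X u∈ = m∉X (∈-image (inj₁ (subst (_∈ X) (sym φ-merged) u∈)))

      v∉X : v ∉ X
      v∉X v∈ = m∉X (∈-image (inj₂ (refl , v∈)))

      u∉φmid : All (u ≢_) φmid
      u∉φmid = All.map⁺ (All.map (λ m≢x → φ≢u m≢x ∘ sym) m∉)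

      v∉φmid : All (v ≢_) φmid
      v∉φmid = All.map⁺ (All.tabulate λ {x} _ → v≢φ x)

      splice : ∀ {α β} → Adj E α β → Adj E β (φ s) → Adj E (φ p) α → α ∉ X → β ∉ X
             → All (α ≢_) φmid → All (β ≢_) φmid → Cycle (Adj E) (_∉ X) α (β ∷ φmid)
      splice {α} αβ βs pα α∉X β∉X α∉ β∉ = cycle
        (αβ ∷ βs ∷ Linked-map edge-away-from-merged m∉ path)
        (subst (λ x → Adj E x α) (sym (lastOf-map φ s mid)) pα)
        ((Adj-irrefl G αβ ∷ α∉) ∷ β∉ ∷ Unique.map⁺ φ-injective distinct)
        (s≤s (s≤s z≤n))
        (α∉X ∷ β∉X ∷ All.map⁺ (All.map ∉-image⇒φ∉ ps))

      close : Adj E u (φ s) ⊎ Adj E v (φ s) → Adj E u (φ p) ⊎ Adj E v (φ p) → ∃₂ (Cycle (Adj E) (_∉ X))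
      close (inj₂ v~φs) (inj₁ u~φp) = _ , _ , splice u~v v~φs (Adj-sym G u~φp) u∉X v∉X u∉φmid v∉φmid
      close (inj₁ u~φs) (inj₂ v~φp) = _ , _ , splice (Adj-sym G u~v) u~φs (Adj-sym G v~φp) v∉X u∉X v∉φmid u∉φmid
      close (inj₂ v~φs) (inj₂ v~φp) =
        ⊥-elim ([ φ≢u (All.head m∉) , φ≢u (All.lookup m∉ (lastOf∈ s mid)) ]′
          (deg≡2⇒third-neighbour G deg-v (Adj-sym G u~v) v~φs v~φp φs≢φp))
      close (inj₁ u~φs) (inj₁ u~φp) =
        ⊥-elim ([ v≢φ s ∘ sym , v≢φ p ∘ sym ]′ (deg≡2⇒third-neighbour G deg-u u~v u~φs u~φp φs≢φp))

    cycle-from-contraction : ∀ X {h ys} → Cycle (Adj E′) (_∉ image X) h ys → ∃₂ (Cycle (Adj E) (_∉ X))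
    cycle-from-contraction X {h} {ys} c with any? (merged ≟_) (h ∷ ys)
    ... | yes m∈ = cycle-through-merged X (proj₂ (rotate-to m∈ c))
    ... | no  m∉ = _ , _ , Cycle-map φ φ-injective
      (λ (_ , m≢x) (_ , m≢y) → edge-away-from-merged m≢x m≢y)
      (∉-image⇒φ∉ ∘ proj₁)
      (restrict c (¬Any⇒All¬ (h ∷ ys) m∉))

    cycle-at-v : ∀ X xs → Cycle (Adj E) (_∉ X) v (map φ xs) → ∃₂ (Cycle (Adj E′) (_∉ image X))
    cycle-at-v X (_ ∷ []) (cycle _ _ _ (s≤s ()) _)
    cycle-at-v X (s ∷ z ∷ []) (cycle (v~φs ∷ φs~φz ∷ [-]) closing (_ ∷ (φs≢φz ∷ []) ∷ _) _ _)
      with deg≡2⇒third-neighbour G deg-v (Adj-sym G u~v) v~φs (Adj-sym G closing) φs≢φz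
    -- a triangle through v and u would give u and v a common neighbour
    ... | inj₁ φs≡u = ⊥-elim (no-common-neighbour (subst (λ w → Adj E w (φ z)) φs≡u φs~φz) (Adj-sym G closing))
    ... | inj₂ φz≡u = ⊥-elim (no-common-neighbour (Adj-sym G (subst (Adj E (φ s)) φz≡u φs~φz)) v~φs)
    cycle-at-v X (s ∷ mid@(_ ∷ _ ∷ _)) (cycle (v~φs ∷ path) closing (_ ∷ distinct) _ (v∉X ∷ ps)) =
      _ , _ , cycle
        (Linked.map edge-contract (Linked.map⁻ path))
        (contract-adj⁺ (φs≢φp ∘ cong φ ∘ sym) closing-edge)
        (Unique.map⁻ distinct)
        (s≤s (s≤s z≤n))
        (All.map (λ φx∉ → ∉-image φx∉ λ _ → v∉X) (All.map⁻ ps))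
      where
      p = lastOf s mid

      φp~v : Adj E (φ p) v
      φp~v = subst (λ x → Adj E x v) (lastOf-map φ s mid) closing

      φs≢φp : φ s ≢ φ p
      φs≢φp = head≢lastOf (Unique.map⁻ distinct) ∘ φ-injective

      closing-edge : MergedEdge p s
      closing-edge with deg≡2⇒third-neighbour G deg-v (Adj-sym G u~v) v~φs (Adj-sym G φp~v) φs≢φp
      ... | inj₁ φs≡u = v-edgeʳ φs≡u φp~v
      ... | inj₂ φp≡u = v-edgeˡ φp≡u v~φs

    cycle-through-v : ∀ X {ys} → Cycle (Adj E) (_∉ X) v ys → ∃₂ (Cycle (Adj E′) (_∉ image X))
    cycle-through-v X {ys} c@(cycle _ _ (v∉ys ∷ _) _ _) with pull-back ys v∉ys
    ... | xs , refl = cycle-at-v X xs c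

    ¬cycle-through-u : ∀ {P : Pred (Fin (suc m)) 0ℓ} {ys} → ¬ Cycle (Adj E) (λ y → P y × v ≢ y) u ys
    ¬cycle-through-u {ys = _ ∷ []} (cycle _ _ _ (s≤s ()) _)
    ¬cycle-through-u {ys = s ∷ z ∷ zs} (cycle (u~s ∷ _) closing (_ ∷ distinct) _ (_ ∷ ps)) =
      [ proj₂ (All.head ps) ∘ sym , proj₂ (All.lookup ps (lastOf∈ s (z ∷ zs))) ∘ sym ]′
        (deg≡2⇒third-neighbour G deg-u u~v u~s (Adj-sym G closing) (head≢lastOf distinct))

    cycle-avoiding-v : ∀ X {h ys} → Cycle (Adj E) (λ y → y ∉ X × v ≢ y) h ys
                     → ∃₂ (Cycle (Adj E′) (_∉ image X))
    cycle-avoiding-v X {h} {ys} c with any? (u ≟_) (h ∷ ys)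
    ... | yes u∈ = ⊥-elim (¬cycle-through-u (proj₂ (rotate-to u∈ c)))
    ... | no  u∉ with pull-back (h ∷ ys) (All.map proj₂ (Cycle.vertices c))
    ...   | x ∷ xs , refl = _ , _ , Cycle-comap φ edge-contract
      (λ ((φx∉ , _) , u≢φx) → ∉-image φx∉ λ x≡m → ⊥-elim (u≢φx (trans (sym φ-merged) (cong φ (sym x≡m)))))
      (restrict c (¬Any⇒All¬ (h ∷ ys) u∉))

    cycle-to-contraction : ∀ X {h ys} → Cycle (Adj E) (_∉ X) h ys → ∃₂ (Cycle (Adj E′) (_∉ image X))
    cycle-to-contraction X {h} {ys} c with any? (v ≟_) (h ∷ ys)
    ... | yes v∈ = cycle-through-v X (proj₂ (rotate-to v∈ c))
    ... | no  v∉ = cycle-avoiding-v X (restrict c (¬Any⇒All¬ (h ∷ ys) v∉))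

    IsFVS-image : ∀ {X} → IsFVS E X → IsFVS E′ (image X)
    IsFVS-image {X} fvs = acyclic⇒IsFVS λ c → let _ , _ , c′ = cycle-from-contraction X c in IsFVS⇒acyclic fvs c′

    IsFVS-image⁻ : ∀ {X} → IsFVS E′ (image X) → IsFVS E X
    IsFVS-image⁻ {X} fvs = acyclic⇒IsFVS λ c → let _ , _ , c′ = cycle-to-contraction X c in IsFVS⇒acyclic fvs c′

    minimal⇒¬both : ∀ {T} → IsMinimalFVS E T → ¬ (u ∈ T × v ∈ T)
    minimal⇒¬both {T} (fvs , minimal) (u∈ , v∈) =
      minimal (T - v) (x∈p⇒p-x⊂p v∈) (IsFVS-image⁻ (subst (IsFVS E′) (sym same-image) (IsFVS-image fvs)))
      where
      same-image : image (T - v) ≡ image T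
      same-image = ⊆-antisym (image-mono (p─q⊆p T _)) λ x∈ → ∈-image {T - v} (inj₁ ([
        (λ φx∈ → x∈p∧x≢y⇒x∈p-y φx∈ (v≢φ _ ∘ sym)) ,
        (λ (x≡m , _) → subst (_∈ T - v) (sym (trans (cong φ x≡m) φ-merged)) (x∈p∧x≢y⇒x∈p-y u∈ (v≢u ∘ sym)))
        ]′ (∈-image⁻ x∈)))

    minimal-lift : ∀ {S} → IsMinimalFVS E′ S → IsMinimalFVS E (lift S)
    minimal-lift {S} (fvs , minimal) =
      IsFVS-image⁻ (subst (IsFVS E′) (sym (image-lift S)) fvs) ,
      λ T T⊂ fvsT → minimal (image T) (image-⊂ T⊂) (IsFVS-image fvsT)
      where
      image-⊂ : ∀ {T} → T ⊂ lift S → image T ⊂ S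
      image-⊂ {T} (T⊆ , y , y∈ , y∉T) =
        subst (image T ⊆_) (image-lift S) (image-mono T⊆) ,
        x , ∈-lift⁻ (subst (_∈ lift S) (sym φx≡y) y∈) ,
        ∉-image (subst (_∉ T) (sym φx≡y) y∉T) (λ _ → v∉lift ∘ T⊆)
        where
        v≢y : v ≢ y
        v≢y v≡y = v∉lift (subst (_∈ lift S) (sym v≡y) y∈)
        x = punchOut v≢y
        φx≡y : φ x ≡ y
        φx≡y = punchIn-punchOut v≢y

    minimal-image : ∀ {T} → IsMinimalFVS E T → IsMinimalFVS E′ (image T)
    minimal-image {T} (fvs , minimal) =
      IsFVS-image fvs ,
      λ R R⊂ fvsR → minimal (T ∩ preimage R) (restrict-⊂ R⊂)
        (IsFVS-image⁻ (subst (IsFVS E′) (sym (image-restrict (proj₁ R⊂))) fvsR))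
      where
      restrict-⊂ : ∀ {R} → R ⊂ image T → T ∩ preimage R ⊂ T
      restrict-⊂ {R} (_ , x , x∈ , x∉R) with ∈-image⁻ x∈
      ... | inj₁ φx∈T        = p∩q⊆p T _ , φ x , φx∈T , x∉R ∘ ∈-preimage⁻ ∘ proj₂ ∘ x∈p∩q⁻ T _
      ... | inj₂ (refl , v∈T) = p∩q⊆p T _ , v , v∈T , x∉R ∘ v∈preimage⁻ ∘ proj₂ ∘ x∈p∩q⁻ T _

mmfvs-transfer : ∀ {a b} {E₁ : Fin a → Fin a → Bool} {E₂ : Fin b → Fin b → Bool}
  (f : Subset a → Subset b) (g : Subset b → Subset a)
  → (∀ {S} → IsMinimalFVS E₁ S → IsMinimalFVS E₂ (f S) × ∣ f S ∣ ≡ ∣ S ∣)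
  → (∀ {T} → IsMinimalFVS E₂ T → IsMinimalFVS E₁ (g T) × ∣ g T ∣ ≡ ∣ T ∣)
  → ∀ {k} → IsMMFVS E₁ k → IsMMFVS E₂ k
mmfvs-transfer f g f-minimal g-minimal ((S , minS , refl) , maximum) =
  (f S , f-minimal minS) ,
  λ T minT → let minT′ , ∣gT∣ = g-minimal minT in subst (_≤ ∣ S ∣) ∣gT∣ (maximum (g T) minT′)

lemma4 : ∀ {m} (G : Graph (suc m)) (u v : Fin (suc m))
         → Adj (adj G) u v
         → (∀ w → w ∈ N G u → ¬ (w ∈ N G v))
         → deg G u ≡ 2 → deg G v ≡ 2
         → ∀ (k : ℕ) → (IsMMFVS (contract G u v) k → IsMMFVS (adj G) k)
                      × (IsMMFVS (adj G) k → IsMMFVS (contract G u v) k)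
lemma4 G u v u~v disjoint deg-u deg-v k =
  mmfvs-transfer lift image lift-minimal image-minimal ,
  mmfvs-transfer image lift image-minimal lift-minimal
  where
  open Contraction G u v u~v
  open DegreeTwo disjoint deg-u deg-v

  lift-minimal : ∀ {S} → IsMinimalFVS (contract G u v) S → IsMinimalFVS (adj G) (lift S) × ∣ lift S ∣ ≡ ∣ S ∣
  lift-minimal {S} minS = minimal-lift minS , ∣lift∣ S

  image-minimal : ∀ {T} → IsMinimalFVS (adj G) T → IsMinimalFVS (contract G u v) (image T) × ∣ image T ∣ ≡ ∣ T ∣
  image-minimal {T} minT = minimal-image minT , ∣image∣ T (minimal⇒¬both minT)
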